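{- Let $F(x,y)=ax^3+bx^2y+cxy^2+dy^3$ be an integral binary cubic form whose associated cubic ring $R_F$ is maximal. (1) If $F$ is congruent modulo $3$ to the cube of a linear form, then $F$ is $\mathrm{GL}_2(\mathbf{Z})$-equivalent to a form $a'x^3+b'x^2y+c'xy^2+d'y^3$ with $a'\equiv b'\equiv c'\equiv0\pmod 3$ and $d'\not\equiv0\pmod3$. (2) If $F\equiv G_1G_2^2\pmod 3$ where $G_1,G_2$ are linear forms that are not constant multiples of each other modulo $3$, then $F$ is $\mathrm{GL}_2(\mathbf{Z})$-equivalent to a form $a'x^3+b'x^2y+c'xy^2+d'y^3$ with $a'\equiv b'\equiv d'\equiv0\pmod3$ and $c'\not\equiv0\pmod3$.
   Context: $R_F$ is the cubic ring with $\mathbf{Z}$-basis $1,\alpha,\beta$ and multiplication $\alpha\beta=-ad$, $\alpha^2=-ac-b\alpha+a\beta$, $\beta^2=-bd-d\alpha+c\beta$. A cubic ring (commutative unital ring free of rank 3 over $\mathbf{Z}$) is maximal if it is not properly contained with finite index in another cubic ring. $\mathrm{GL}_2(\mathbf{Z})$ acts on binary cubic forms by the twisted action $(g\cdot F)(x,y)=\frac{1}{\det g}F((x,y)g)$. -}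

module Defs where

open import Data.Integer using (ℤ; +_; -_; _+_; _-_; _*_)
open import Data.Integer.Divisibility using (_∣_)
open import Data.Fin using (Fin; zero; suc)
open import Data.Product using (Σ; ∃; _×_; _,_)
open import Data.Sum using (_⊎_)
open import Relation.Binary.PropositionalEquality using (_≡_)
open import Relation.Nullary using (¬_)

record Form : Set where
  constructor form
  field
    a b c d : ℤ
open Form public

evalF : Form → ℤ → ℤ → ℤ
evalF F x y = a F * (x * x * x) + b F * (x * x * y) + c F * (x * y * y) + d F * (y * y * y)

record Lin : Set where
  constructor lin
  field
    u v : ℤ
open Lin public

lin3 : Lin → Lin → Lin → Form
lin3 (lin u₁ v₁) (lin u₂ v₂) (lin u₃ v₃) =
  form (u₁ * u₂ * u₃)
       (u₁ * u₂ * v₃ + u₁ * v₂ * u₃ + v₁ * u₂ * u₃)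
       (u₁ * v₂ * v₃ + v₁ * u₂ * v₃ + v₁ * v₂ * u₃)
       (v₁ * v₂ * v₃)

infix 4 _≡₃_ _≡F₃_ _≡L₃_ _≈_
_≡₃_ : ℤ → ℤ → Set
m ≡₃ n = (+ 3) ∣ (m - n)

_≡F₃_ : Form → Form → Set
F ≡F₃ G = (a F ≡₃ a G) × (b F ≡₃ b G) × (c F ≡₃ c G) × (d F ≡₃ d G)

_≡L₃_ : Lin → Lin → Set
L ≡L₃ M = (u L ≡₃ u M) × (v L ≡₃ v M)

scaleL : ℤ → Lin → Lin
scaleL k (lin p q) = lin (k * p) (k * q)

ConstMult₃ : Lin → Lin → Set
ConstMult₃ G H = (Σ ℤ λ k → G ≡L₃ scaleL k H) ⊎ (Σ ℤ λ k → H ≡L₃ scaleL k G)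

-- GL₂(ℤ) and the twisted action (g·F)(x,y) = F((x,y)g) / det g,
-- g = [[p , q] , [r , s]], (x,y)g = (p x + r y , q x + s y).

record M₂ : Set where
  constructor mat
  field
    p q r s : ℤ
open M₂ public

det₂ : M₂ → ℤ
det₂ g = p g * s g - q g * r g

InGL₂ : M₂ → Set
InGL₂ g = (det₂ g ≡ + 1) ⊎ (det₂ g ≡ - (+ 1))

-- "G = g · F"  (dividing by det g = ±1 is the same as the identity below)
IsAction : M₂ → Form → Form → Set
IsAction g F G = ∀ x y →
  det₂ g * evalF G x y ≡ evalF F (p g * x + r g * y) (q g * x + s g * y)

GL₂Equiv : Form → Form → Set
GL₂Equiv F G = Σ M₂ λ g → InGL₂ g × IsAction g F G

-- Cubic rings: ℤ³ with a bilinear multiplication given by structure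
-- constants, commutative, associative, with a unit.

V : Set
V = Fin 3 → ℤ

_≈_ : V → V → Set
x ≈ y = ∀ k → x k ≡ y k

sum3 : (Fin 3 → ℤ) → ℤ
sum3 f = f zero + f (suc zero) + f (suc (suc zero))

Table : Set
Table = Fin 3 → Fin 3 → V

mulT : Table → V → V → V
mulT t x y k = sum3 (λ i → sum3 (λ j → x i * y j * t i j k))

scaleV : ℤ → V → V
scaleV n x k = n * x k

record CubicRing : Set where
  field
    table : Table
    one   : V
    comm  : ∀ x y → mulT table x y ≈ mulT table y x
    assoc : ∀ x y z → mulT table (mulT table x y) z ≈ mulT table x (mulT table y z)
    unitˡ : ∀ x → mulT table one x ≈ x
open CubicRing public

-- R_F with basis e₀ = 1, e₁ = α, e₂ = β
vec : ℤ → ℤ → ℤ → V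
vec x y z zero = x
vec x y z (suc zero) = y
vec x y z (suc (suc zero)) = z

oneF : V
oneF = vec (+ 1) (+ 0) (+ 0)

tableF : Form → Table
tableF F zero j = λ k → oneHot j k
  where
  oneHot : Fin 3 → Fin 3 → ℤ
  oneHot zero = vec (+ 1) (+ 0) (+ 0)
  oneHot (suc zero) = vec (+ 0) (+ 1) (+ 0)
  oneHot (suc (suc zero)) = vec (+ 0) (+ 0) (+ 1)
tableF F (suc zero) zero = vec (+ 0) (+ 1) (+ 0)
tableF F (suc (suc zero)) zero = vec (+ 0) (+ 0) (+ 1)
tableF F (suc zero) (suc zero) = vec (- (a F * c F)) (- b F) (a F)
tableF F (suc zero) (suc (suc zero)) = vec (- (a F * d F)) (+ 0) (+ 0)
tableF F (suc (suc zero)) (suc zero) = vec (- (a F * d F)) (+ 0) (+ 0)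
tableF F (suc (suc zero)) (suc (suc zero)) = vec (- (b F * d F)) (- d F) (c F)

-- ℤ-linear maps ℤ³ → ℤ³, given by images of the basis vectors
Mat : Set
Mat = Fin 3 → V

applyM : Mat → V → V
applyM M x k = sum3 (λ i → x i * M i k)

-- R_F is properly contained with finite index in the cubic ring S:
-- an injective unital ring homomorphism φ : R_F → S (hence ℤ-linear)
-- that is not surjective and whose image has finite index.
ProperFiniteIndexOverring : Form → CubicRing → Set
ProperFiniteIndexOverring F S = Σ Mat λ φ →
    (applyM φ oneF ≈ one S)
  × (∀ x y → applyM φ (mulT (tableF F) x y) ≈ mulT (table S) (applyM φ x) (applyM φ y))
  × (∀ x y → applyM φ x ≈ applyM φ y → x ≈ y)
  × (Σ V λ y → ∀ x → ¬ (applyM φ x ≈ y))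
  × (Σ ℤ λ N → ¬ (N ≡ + 0) × (∀ y → Σ V λ x → applyM φ x ≈ scaleV N y))

MaximalRF : Form → Set
MaximalRF F = ∀ (S : CubicRing) → ¬ ProperFiniteIndexOverring F S

{-# OPTIONS --safe #-}
module Submission where

-- Shears and a rotation in SL₂(ℤ) move any
-- nonzero line mod 3 to the y-axis, and then a second shear moves an independent line to the
-- x-axis while fixing the y-axis. After this substitution F ≡ w³y³, resp. F ≡ w₁w₂²xy², with units
-- w, w₁, w₂ mod 3, which is the claim. Maximality only excludes L ≡ 0, i.e. F ≡ 0 (mod 3): then
-- F = 3F′, and α ↦ 3α, β ↦ 3β embeds R_F into R_F′ as a proper subring of finite index.

open import Defs
open import Data.Empty using (⊥-elim)
open import Data.Fin using (Fin)
open import Data.Fin.Patterns using (0F; 1F; 2F)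
open import Data.Integer using (ℤ; +_; -_; _+_; _-_; _*_)
open import Data.Integer.DivMod using (_%_; _/_; n%d<d; a≡a%n+[a/n]*n)
import Data.Integer.Divisibility.Signed as Signed
open import Data.Integer.Properties using (*-identityˡ; *-zeroʳ; *-comm; *-cancelˡ-≡; +-injective)
import Data.Integer.Tactic.RingSolver as ℤ-Solver
open import Data.Integer.Tactic.RingSolver using (solve-∀; solve)
open import Data.List using (_∷_; [])
open import Data.Nat using (ℕ; suc; s≤s; _<_; NonTrivial; nonTrivial⇒nonZero; nonTrivial⇒n>1; ≢-nonZero⁻¹)
open import Data.Nat.Properties using (<-irrefl)
import Data.Nat.Divisibility as ℕ
open import Data.Product using (Σ; _×_; _,_; proj₁)
open import Data.Sum using (_⊎_; inj₁; inj₂)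
open import Data.Vec.N-ary using (N-ary)
open import Function using (_∘_)
open import Relation.Binary using (Setoid)
import Relation.Binary.Reasoning.Setoid as SetoidReasoning
open import Relation.Binary.PropositionalEquality using (_≡_; _≢_; refl; sym; trans; cong; cong₂; subst)
open import Relation.Nullary using (¬_)
open import Tactic.RingSolver.NonReflective ℤ-Solver.ring using (_⊜_; Expr; Κ; _⊕_; _⊗_; ⊝_)
  renaming (solve to solveExpr)

private variable
  x x′ y y′ z : ℤ

-- Congruence modulo 3

-- Defs' _≡₃_ unfolds to a divisibility between absolute values, from which unification cannot
-- recover x and y; wrapping it in a record makes the congruence lemmas below usable with implicit
-- arguments.
infix 4 _≋_
record _≋_ (x y : ℤ) : Set where
  constructor mod3
  field 3∣x-y : + 3 Signed.∣ (x - y)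

≋⇒≡₃ : x ≋ y → x ≡₃ y
≋⇒≡₃ (mod3 3∣x-y) = Signed.∣⇒∣ᵤ 3∣x-y

≡₃⇒≋ : x ≡₃ y → x ≋ y
≡₃⇒≋ x≡₃y = mod3 (Signed.∣ᵤ⇒∣ x≡₃y)

private
  -- subst with the divisibility first, so that both sides of the equation are known when the
  -- solver proves it.
  ∣-resp : ∀ {m n} → + 3 Signed.∣ m → m ≡ n → + 3 Signed.∣ n
  ∣-resp 3∣m refl = 3∣m

≋-by-multiple : ∀ q → x ≡ y + q * + 3 → x ≋ y
≋-by-multiple {x} {y} q x≡y+3q =
  mod3 (Signed.divides q (trans (cong (_- y) x≡y+3q) (solve (y ∷ q ∷ []))))

≋-reflexive : x ≡ y → x ≋ y
≋-reflexive {x} refl = ≋-by-multiple (+ 0) (solve (x ∷ []))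

≋-refl : x ≋ x
≋-refl = ≋-reflexive refl

≋-sym : x ≋ y → y ≋ x
≋-sym {x} {y} (mod3 3∣x-y) = mod3 (∣-resp (Signed.∣m⇒∣-m 3∣x-y) (solve (x ∷ y ∷ [])))

≋-trans : x ≋ y → y ≋ z → x ≋ z
≋-trans {x} {y} {z} (mod3 3∣x-y) (mod3 3∣y-z) =
  mod3 (∣-resp (Signed.∣m∣n⇒∣m+n 3∣x-y 3∣y-z) (solve (x ∷ y ∷ z ∷ [])))

+-cong : x ≋ x′ → y ≋ y′ → x + y ≋ x′ + y′
+-cong {x} {x′} {y} {y′} (mod3 3∣x-x′) (mod3 3∣y-y′) =
  mod3 (∣-resp (Signed.∣m∣n⇒∣m+n 3∣x-x′ 3∣y-y′) (solve (x ∷ x′ ∷ y ∷ y′ ∷ [])))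

*-cong : x ≋ x′ → y ≋ y′ → x * y ≋ x′ * y′
*-cong {x} {x′} {y} {y′} (mod3 3∣x-x′) (mod3 3∣y-y′) =
  mod3 (∣-resp (Signed.∣m∣n⇒∣m+n (Signed.∣m⇒∣m*n y 3∣x-x′) (Signed.∣n⇒∣m*n x′ 3∣y-y′))
               (solve (x ∷ x′ ∷ y ∷ y′ ∷ [])))

-‿cong : x ≋ y → - x ≋ - y
-‿cong {x} {y} (mod3 3∣x-y) = mod3 (∣-resp (Signed.∣m⇒∣-m 3∣x-y) (solve (x ∷ y ∷ [])))

≋-setoid : Setoid _ _
≋-setoid = record
  { Carrier = ℤ
  ; _≈_ = _≋_
  ; isEquivalence = record { refl = ≋-refl ; sym = ≋-sym ; trans = ≋-trans }
  }

module ≋-Reasoning = SetoidReasoning ≋-setoid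

1≉0 : ¬ (+ 1 ≋ + 0)
1≉0 1≋0 with ℕ.∣1⇒≡1 (≋⇒≡₃ 1≋0)
... | ()

x≋0∨x²≋1 : ∀ x → x ≋ + 0 ⊎ x * x ≋ + 1
x≋0∨x²≋1 x = by-remainder (x % + 3) (n%d<d x (+ 3)) (≋-by-multiple (x / + 3) (a≡a%n+[a/n]*n x (+ 3)))
  where
  by-remainder : ∀ r → r < 3 → x ≋ + r → x ≋ + 0 ⊎ x * x ≋ + 1
  by-remainder 0 _ x≋0 = inj₁ x≋0
  by-remainder 1 _ x≋1 = inj₂ (*-cong x≋1 x≋1)
  by-remainder 2 _ x≋2 = inj₂ (≋-trans (*-cong x≋2 x≋2) (≋-by-multiple (+ 1) refl))
  by-remainder (suc (suc (suc _))) (s≤s (s≤s (s≤s ()))) _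

x²≋1⇒x≉0 : x * x ≋ + 1 → ¬ x ≋ + 0
x²≋1⇒x≉0 x²≋1 x≋0 = 1≉0 (≋-trans (≋-sym x²≋1) (*-cong x≋0 x≋0))

x≉0⇒x²≋1 : ¬ x ≋ + 0 → x * x ≋ + 1
x≉0⇒x²≋1 {x} x≉0 with x≋0∨x²≋1 x
... | inj₁ x≋0 = ⊥-elim (x≉0 x≋0)
... | inj₂ x²≋1 = x²≋1

≋0⊎≉0 : ∀ x → x ≋ + 0 ⊎ ¬ x ≋ + 0
≋0⊎≉0 x with x≋0∨x²≋1 x
... | inj₁ x≋0 = inj₁ x≋0
... | inj₂ x²≋1 = inj₂ (x²≋1⇒x≉0 x²≋1)

y*x²≋y : ∀ y → ¬ x ≋ + 0 → y * (x * x) ≋ y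
y*x²≋y {x} y x≉0 = begin
  y * (x * x)  ≈⟨ *-cong (≋-refl {y}) (x≉0⇒x²≋1 x≉0) ⟩
  y * + 1      ≡⟨ solve (y ∷ []) ⟩
  y            ∎
  where open ≋-Reasoning

x≉0∧y≉0⇒xy≉0 : ¬ x ≋ + 0 → ¬ y ≋ + 0 → ¬ x * y ≋ + 0
x≉0∧y≉0⇒xy≉0 {x} {y} x≉0 y≉0 = x²≋1⇒x≉0 (begin
  x * y * (x * y)    ≡⟨ solve (x ∷ y ∷ []) ⟩
  (x * x) * (y * y)  ≈⟨ *-cong (x≉0⇒x²≋1 x≉0) (x≉0⇒x²≋1 y≉0) ⟩
  + 1                ∎)
  where open ≋-Reasoning

xy≉0⇒x≉0 : ¬ x * y ≋ + 0 → ¬ x ≋ + 0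
xy≉0⇒x≉0 {x} {y} xy≉0 x≋0 = xy≉0 (begin
  x * y    ≈⟨ *-cong x≋0 (≋-refl {y}) ⟩
  + 0 * y  ≡⟨ solve (y ∷ []) ⟩
  + 0      ∎)
  where open ≋-Reasoning

≉0-resp : ¬ y ≋ + 0 → x ≋ y → ¬ x ≋ + 0
≉0-resp y≉0 x≋y x≋0 = y≉0 (≋-trans (≋-sym x≋y) x≋0)

≉0⇒≢₃0 : ¬ y ≋ + 0 → x ≋ y → ¬ x ≡₃ + 0
≉0⇒≢₃0 y≉0 x≋y = ≉0-resp y≉0 x≋y ∘ ≡₃⇒≋

-- Linear forms and substitutions

infix 4 _≋L_
record _≋L_ (L M : Lin) : Set where
  constructor lin≋
  field
    u≋ : u L ≋ u M
    v≋ : v L ≋ v M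

≋L⇒≡L₃ : ∀ {L M} → L ≋L M → L ≡L₃ M
≋L⇒≡L₃ (lin≋ u≋ v≋) = ≋⇒≡₃ u≋ , ≋⇒≡₃ v≋

infixl 7 _∙_
_∙_ : M₂ → M₂ → M₂
mat p q r s ∙ mat p′ q′ r′ s′ = mat (p * p′ + q * r′) (p * q′ + q * s′) (r * p′ + s * r′) (r * q′ + s * s′)

det₂-∙ : ∀ g h → det₂ (g ∙ h) ≡ det₂ g * det₂ h
det₂-∙ (mat p q r s) (mat p′ q′ r′ s′) = identity p q r s p′ q′ r′ s′
  where
  identity : ∀ p q r s p′ q′ r′ s′ →
    (p * p′ + q * r′) * (r * q′ + s * s′) - (p * q′ + q * s′) * (r * p′ + s * r′)
      ≡ (p * s - q * r) * (p′ * s′ - q′ * r′)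
  identity = solve-∀

evalL : Lin → ℤ → ℤ → ℤ
evalL L x y = u L * x + v L * y

-- L ∘L g and F ∘F g (below) are L((x,y)g) and F((x,y)g); so F ∘F g is the twisted action g·F when
-- det g = 1.
infixl 8 _∘L_
_∘L_ : Lin → M₂ → Lin
L ∘L mat p q r s = lin (evalL L p q) (evalL L r s)

∘L-∙ : ∀ L g h → L ∘L h ∘L g ≡ L ∘L (g ∙ h)
∘L-∙ (lin u v) (mat p q r s) (mat p′ q′ r′ s′) =
  cong₂ lin (identity u v p q p′ q′ r′ s′) (identity u v r s p′ q′ r′ s′)
  where
  identity : ∀ u v p q p′ q′ r′ s′ →
    (u * p′ + v * q′) * p + (u * r′ + v * s′) * q ≡ u * (p * p′ + q * r′) + v * (p * q′ + q * s′)
  identity = solve-∀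

cross : Lin → Lin → ℤ
cross L M = u L * v M - v L * u M

cross-∘L : ∀ L M g → cross (L ∘L g) (M ∘L g) ≡ det₂ g * cross L M
cross-∘L (lin u₁ v₁) (lin u₂ v₂) (mat p q r s) = identity u₁ v₁ u₂ v₂ p q r s
  where
  identity : ∀ u₁ v₁ u₂ v₂ p q r s →
    (u₁ * p + v₁ * q) * (u₂ * r + v₂ * s) - (u₁ * r + v₁ * s) * (u₂ * p + v₂ * q)
      ≡ (p * s - q * r) * (u₁ * v₂ - v₁ * u₂)
  identity = solve-∀

-- Units are their own inverses modulo 3, so the factor v₁/v₂ (resp. u₁/u₂) is v₁v₂ (resp. u₁u₂).
cross≋0⇒ConstMult₃ : ∀ L M → cross L M ≋ + 0 → ConstMult₃ L M
cross≋0⇒ConstMult₃ (lin u₁ v₁) (lin u₂ v₂) cross≋0 with ≋0⊎≉0 v₂ | ≋0⊎≉0 u₂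
... | inj₂ v₂≉0 | _ = inj₁ (v₁ * v₂ , ≋L⇒≡L₃ (lin≋ u₁≋ v₁≋))
  where
  open ≋-Reasoning
  u₁≋ : u₁ ≋ v₁ * v₂ * u₂
  u₁≋ = begin
    u₁                                       ≈⟨ ≋-sym (y*x²≋y u₁ v₂≉0) ⟩
    u₁ * (v₂ * v₂)                           ≡⟨ solve (u₁ ∷ v₁ ∷ u₂ ∷ v₂ ∷ []) ⟩
    (u₁ * v₂ - v₁ * u₂) * v₂ + v₁ * v₂ * u₂  ≈⟨ +-cong (*-cong cross≋0 (≋-refl {v₂})) (≋-refl {v₁ * v₂ * u₂}) ⟩
    + 0 * v₂ + v₁ * v₂ * u₂                  ≡⟨ solve (v₁ ∷ u₂ ∷ v₂ ∷ []) ⟩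
    v₁ * v₂ * u₂                             ∎
  v₁≋ : v₁ ≋ v₁ * v₂ * v₂
  v₁≋ = begin
    v₁              ≈⟨ ≋-sym (y*x²≋y v₁ v₂≉0) ⟩
    v₁ * (v₂ * v₂)  ≡⟨ solve (v₁ ∷ v₂ ∷ []) ⟩
    v₁ * v₂ * v₂    ∎
... | inj₁ v₂≋0 | inj₂ u₂≉0 = inj₁ (u₁ * u₂ , ≋L⇒≡L₃ (lin≋ u₁≋ v₁≋))
  where
  open ≋-Reasoning
  u₁≋ : u₁ ≋ u₁ * u₂ * u₂
  u₁≋ = begin
    u₁              ≈⟨ ≋-sym (y*x²≋y u₁ u₂≉0) ⟩
    u₁ * (u₂ * u₂)  ≡⟨ solve (u₁ ∷ u₂ ∷ []) ⟩
    u₁ * u₂ * u₂    ∎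
  v₁≋ : v₁ ≋ u₁ * u₂ * v₂
  v₁≋ = begin
    v₁                                    ≈⟨ ≋-sym (y*x²≋y v₁ u₂≉0) ⟩
    v₁ * (u₂ * u₂)                        ≡⟨ solve (u₁ ∷ v₁ ∷ u₂ ∷ v₂ ∷ []) ⟩
    (u₁ * v₂ - (u₁ * v₂ - v₁ * u₂)) * u₂
      ≈⟨ *-cong (+-cong (*-cong (≋-refl {u₁}) v₂≋0) (-‿cong cross≋0)) (≋-refl {u₂}) ⟩
    (u₁ * + 0 - + 0) * u₂                 ≡⟨ solve (u₁ ∷ u₂ ∷ []) ⟩
    u₁ * u₂ * + 0                         ≈⟨ *-cong (≋-refl {u₁ * u₂}) (≋-sym v₂≋0) ⟩
    u₁ * u₂ * v₂                          ∎
... | inj₁ v₂≋0 | inj₁ u₂≋0 = inj₂ (+ 0 , ≋L⇒≡L₃ (lin≋ u₂≋0 v₂≋0))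

cross≉0⇒M≉0 : ∀ L M → ¬ cross L M ≋ + 0 → ¬ M ≋L lin (+ 0) (+ 0)
cross≉0⇒M≉0 (lin u₁ v₁) (lin u₂ v₂) cross≉0 (lin≋ u₂≋0 v₂≋0) = cross≉0 (begin
  u₁ * v₂ - v₁ * u₂    ≈⟨ +-cong (*-cong (≋-refl {u₁}) v₂≋0) (-‿cong (*-cong (≋-refl {v₁}) u₂≋0)) ⟩
  u₁ * + 0 - v₁ * + 0  ≡⟨ solve (u₁ ∷ v₁ ∷ []) ⟩
  + 0                  ∎)
  where open ≋-Reasoning

cross≉0⇒u≉0 : ∀ L M → u M ≋ + 0 → ¬ cross L M ≋ + 0 → ¬ u L ≋ + 0
cross≉0⇒u≉0 (lin u₁ v₁) (lin u₂ v₂) u₂≋0 cross≉0 = xy≉0⇒x≉0 (≉0-resp cross≉0 (begin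
  u₁ * v₂             ≡⟨ solve (u₁ ∷ v₁ ∷ v₂ ∷ []) ⟩
  u₁ * v₂ - v₁ * + 0  ≈⟨ +-cong (≋-refl {u₁ * v₂}) (-‿cong (*-cong (≋-refl {v₁}) (≋-sym u₂≋0))) ⟩
  u₁ * v₂ - v₁ * u₂   ∎))
  where open ≋-Reasoning

-- Moving lines to the coordinate axes modulo 3

UnitMultipleOfX UnitMultipleOfY : Lin → Set
UnitMultipleOfX L = ¬ u L ≋ + 0 × v L ≋ + 0
UnitMultipleOfY L = u L ≋ + 0 × ¬ v L ≋ + 0

shear₁₂ shear₂₁ : ℤ → M₂
shear₁₂ t = mat (+ 1) t (+ 0) (+ 1)
shear₂₁ t = mat (+ 1) (+ 0) t (+ 1)

rotation : M₂
rotation = mat (+ 0) (- + 1) (+ 1) (+ 0)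

det₂-shear₁₂ : ∀ t → det₂ (shear₁₂ t) ≡ + 1
det₂-shear₁₂ t = cong (λ z → + 1 - z) (*-zeroʳ t)

det₂-shear₂₁ : ∀ t → det₂ (shear₂₁ t) ≡ + 1
det₂-shear₂₁ t = refl

align-y : ∀ L → ¬ L ≋L lin (+ 0) (+ 0) → Σ M₂ λ g → det₂ g ≡ + 1 × UnitMultipleOfY (L ∘L g)
align-y (lin u v) L≉0 with ≋0⊎≉0 v | ≋0⊎≉0 u
... | inj₂ v≉0 | _ = shear₁₂ (- (u * v)) , det₂-shear₁₂ (- (u * v)) , u′≋0 , ≉0-resp v≉0 v′≋v
  where
  open ≋-Reasoning
  u′≋0 : u * + 1 + v * - (u * v) ≋ + 0
  u′≋0 = begin
    u * + 1 + v * - (u * v)  ≡⟨ solve (u ∷ v ∷ []) ⟩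
    u - u * (v * v)          ≈⟨ +-cong (≋-refl {u}) (-‿cong (y*x²≋y u v≉0)) ⟩
    u - u                    ≡⟨ solve (u ∷ []) ⟩
    + 0                      ∎
  v′≋v : u * + 0 + v * + 1 ≋ v
  v′≋v = ≋-reflexive (solve (u ∷ v ∷ []))
... | inj₁ v≋0 | inj₂ u≉0 = rotation , refl , u′≋0 , ≉0-resp u≉0 v′≋u
  where
  open ≋-Reasoning
  u′≋0 : u * + 0 + v * - + 1 ≋ + 0
  u′≋0 = begin
    u * + 0 + v * - + 1  ≡⟨ solve (u ∷ v ∷ []) ⟩
    - v                  ≈⟨ -‿cong v≋0 ⟩
    + 0                  ∎
  v′≋u : u * + 1 + v * + 0 ≋ u
  v′≋u = ≋-reflexive (solve (u ∷ v ∷ []))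
... | inj₁ v≋0 | inj₁ u≋0 = ⊥-elim (L≉0 (lin≋ u≋0 v≋0))

align-x-fixing-y : ∀ L M → ¬ u L ≋ + 0 → UnitMultipleOfY M →
  Σ M₂ λ h → det₂ h ≡ + 1 × UnitMultipleOfX (L ∘L h) × UnitMultipleOfY (M ∘L h)
align-x-fixing-y (lin w z) (lin u′ v′) w≉0 (u′≋0 , v′≉0) =
  shear₂₁ (- (z * w)) , det₂-shear₂₁ (- (z * w)) ,
  (≉0-resp w≉0 w′≋w , z′≋0) , (≋-trans u″≋u′ u′≋0 , ≉0-resp v′≉0 v″≋v′)
  where
  open ≋-Reasoning
  w′≋w : w * + 1 + z * + 0 ≋ w
  w′≋w = ≋-reflexive (solve (w ∷ z ∷ []))
  z′≋0 : w * - (z * w) + z * + 1 ≋ + 0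
  z′≋0 = begin
    w * - (z * w) + z * + 1  ≡⟨ solve (w ∷ z ∷ []) ⟩
    z - z * (w * w)          ≈⟨ +-cong (≋-refl {z}) (-‿cong (y*x²≋y z w≉0)) ⟩
    z - z                    ≡⟨ solve (z ∷ []) ⟩
    + 0                      ∎
  u″≋u′ : u′ * + 1 + v′ * + 0 ≋ u′
  u″≋u′ = ≋-reflexive (solve (u′ ∷ v′ ∷ []))
  v″≋v′ : u′ * - (z * w) + v′ * + 1 ≋ v′
  v″≋v′ = begin
    u′ * - (z * w) + v′ * + 1   ≈⟨ +-cong (*-cong u′≋0 (≋-refl { - (z * w)})) (≋-refl {v′ * + 1}) ⟩
    + 0 * - (z * w) + v′ * + 1  ≡⟨ solve (z ∷ w ∷ v′ ∷ []) ⟩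
    v′                          ∎

align-xy : ∀ L M → ¬ cross L M ≋ + 0 →
  Σ M₂ λ g → det₂ g ≡ + 1 × UnitMultipleOfX (L ∘L g) × UnitMultipleOfY (M ∘L g)
align-xy L M cross≉0 =
  let g , det-g≡1 , M∘g-y = align-y M (cross≉0⇒M≉0 L M cross≉0)
      cross∘g≡cross = trans (cross-∘L L M g) (trans (cong (_* cross L M) det-g≡1) (*-identityˡ (cross L M)))
      L∘g-u≉0 = cross≉0⇒u≉0 (L ∘L g) (M ∘L g) (proj₁ M∘g-y) (≉0-resp cross≉0 (≋-reflexive cross∘g≡cross))
      h , det-h≡1 , L∘g∘h-x , M∘g∘h-y = align-x-fixing-y (L ∘L g) (M ∘L g) L∘g-u≉0 M∘g-y
  in h ∙ g , trans (det₂-∙ h g) (cong₂ _*_ det-h≡1 det-g≡1) ,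
     subst UnitMultipleOfX (∘L-∙ L h g) L∘g∘h-x , subst UnitMultipleOfY (∘L-∙ M h g) M∘g∘h-y

-- Binary cubic forms modulo 3

infix 4 _≋F_
record _≋F_ (F G : Form) : Set where
  constructor form≋
  field
    a≋ : a F ≋ a G
    b≋ : b F ≋ b G
    c≋ : c F ≋ c G
    d≋ : d F ≋ d G

≡F₃⇒≋F : ∀ {F G} → F ≡F₃ G → F ≋F G
≡F₃⇒≋F (a≡ , b≡ , c≡ , d≡) = form≋ (≡₃⇒≋ a≡) (≡₃⇒≋ b≡) (≡₃⇒≋ c≡) (≡₃⇒≋ d≡)

≋F-refl : ∀ {F} → F ≋F F
≋F-refl = form≋ ≋-refl ≋-refl ≋-refl ≋-refl

≋F-sym : ∀ {F G} → F ≋F G → G ≋F F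
≋F-sym (form≋ a≋ b≋ c≋ d≋) = form≋ (≋-sym a≋) (≋-sym b≋) (≋-sym c≋) (≋-sym d≋)

≋F-trans : ∀ {F G H} → F ≋F G → G ≋F H → F ≋F H
≋F-trans (form≋ a≋ b≋ c≋ d≋) (form≋ a≋′ b≋′ c≋′ d≋′) =
  form≋ (≋-trans a≋ a≋′) (≋-trans b≋ b≋′) (≋-trans c≋ c≋′) (≋-trans d≋ d≋′)

≋F-setoid : Setoid _ _
≋F-setoid = record
  { Carrier = Form
  ; _≈_ = _≋F_
  ; isEquivalence = record { refl = ≋F-refl ; sym = ≋F-sym ; trans = ≋F-trans }
  }

module ≋F-Reasoning = SetoidReasoning ≋F-setoid

lin3-cong : ∀ {L₁ L₂ L₃ M₁ M₂ M₃} → L₁ ≋L M₁ → L₂ ≋L M₂ → L₃ ≋L M₃ → lin3 L₁ L₂ L₃ ≋F lin3 M₁ M₂ M₃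
lin3-cong (lin≋ u₁ v₁) (lin≋ u₂ v₂) (lin≋ u₃ v₃) = form≋
  (*-cong (*-cong u₁ u₂) u₃)
  (+-cong (+-cong (*-cong (*-cong u₁ u₂) v₃) (*-cong (*-cong u₁ v₂) u₃)) (*-cong (*-cong v₁ u₂) u₃))
  (+-cong (+-cong (*-cong (*-cong u₁ v₂) v₃) (*-cong (*-cong v₁ u₂) v₃)) (*-cong (*-cong v₁ v₂) u₃))
  (*-cong (*-cong v₁ v₂) v₃)

pairing : Form → ℤ → ℤ → ℤ → ℤ → ℤ
pairing F k₁ k₂ k₃ k₄ = a F * k₁ + b F * k₂ + c F * k₃ + d F * k₄

pairing-cong : ∀ {F G} → F ≋F G → ∀ k₁ k₂ k₃ k₄ → pairing F k₁ k₂ k₃ k₄ ≋ pairing G k₁ k₂ k₃ k₄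
pairing-cong (form≋ a≋ b≋ c≋ d≋) k₁ k₂ k₃ k₄ =
  +-cong (+-cong (+-cong (*-cong a≋ (≋-refl {k₁})) (*-cong b≋ (≋-refl {k₂}))) (*-cong c≋ (≋-refl {k₃})))
         (*-cong d≋ (≋-refl {k₄}))

-- The derivative of F at (x, y) in the direction (r, s).
derivative : Form → ℤ → ℤ → ℤ → ℤ → ℤ
derivative F x y r s = pairing F
  (+ 3 * (x * x * r)) (x * x * s + + 2 * (x * r * y)) (r * y * y + + 2 * (x * y * s)) (+ 3 * (y * y * s))

evalF-cong : ∀ {F G} → F ≋F G → ∀ x y → evalF F x y ≋ evalF G x y
evalF-cong F≋G x y = pairing-cong F≋G (x * x * x) (x * x * y) (x * y * y) (y * y * y)

derivative-cong : ∀ {F G} → F ≋F G → ∀ x y r s → derivative F x y r s ≋ derivative G x y r s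
derivative-cong F≋G x y r s = pairing-cong F≋G
  (+ 3 * (x * x * r)) (x * x * s + + 2 * (x * r * y)) (r * y * y + + 2 * (x * y * s)) (+ 3 * (y * y * s))

-- Taylor expansion: F(px + ry, qx + sy) = F(p,q) x³ + D_{(r,s)}F(p,q) x²y + D_{(p,q)}F(r,s) xy² + F(r,s) y³.
infixl 8 _∘F_
_∘F_ : Form → M₂ → Form
F ∘F mat p q r s = form (evalF F p q) (derivative F p q r s) (derivative F r s p q) (evalF F r s)

∘F-cong : ∀ {F G} g → F ≋F G → F ∘F g ≋F G ∘F g
∘F-cong (mat p q r s) F≋G =
  form≋ (evalF-cong F≋G p q) (derivative-cong F≋G p q r s) (derivative-cong F≋G r s p q) (evalF-cong F≋G r s)

GL₂Equiv-∘F : ∀ F g → det₂ g ≡ + 1 → GL₂Equiv F (F ∘F g)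
GL₂Equiv-∘F (form a b c d) (mat p q r s) det≡1 = mat p q r s , inj₁ det≡1 , λ x y →
  trans (cong (_* evalF (form a b c d ∘F mat p q r s) x y) det≡1) (taylor a b c d p q r s x y)
  where
  taylor : ∀ a b c d p q r s x y →
    let F = λ x y → a * (x * x * x) + b * (x * x * y) + c * (x * y * y) + d * (y * y * y)
        D = λ x y r s → a * (+ 3 * (x * x * r)) + b * (x * x * s + + 2 * (x * r * y))
                        + c * (r * y * y + + 2 * (x * y * s)) + d * (+ 3 * (y * y * s))
    in + 1 * (F p q * (x * x * x) + D p q r s * (x * x * y) + D r s p q * (x * y * y) + F r s * (y * y * y))
       ≡ F (p * x + r * y) (q * x + s * y)
  taylor = solve-∀

evalF-lin3 : ∀ L₁ L₂ L₃ x y → evalF (lin3 L₁ L₂ L₃) x y ≡ evalL L₁ x y * evalL L₂ x y * evalL L₃ x y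
evalF-lin3 (lin u₁ v₁) (lin u₂ v₂) (lin u₃ v₃) x y = identity u₁ v₁ u₂ v₂ u₃ v₃ x y
  where
  identity : ∀ u₁ v₁ u₂ v₂ u₃ v₃ x y →
    u₁ * u₂ * u₃ * (x * x * x) + (u₁ * u₂ * v₃ + u₁ * v₂ * u₃ + v₁ * u₂ * u₃) * (x * x * y)
    + (u₁ * v₂ * v₃ + v₁ * u₂ * v₃ + v₁ * v₂ * u₃) * (x * y * y) + v₁ * v₂ * v₃ * (y * y * y)
      ≡ (u₁ * x + v₁ * y) * (u₂ * x + v₂ * y) * (u₃ * x + v₃ * y)
  identity = solve-∀

derivative-lin3 : ∀ L₁ L₂ L₃ x y r s → derivative (lin3 L₁ L₂ L₃) x y r s ≡
  evalL L₁ x y * evalL L₂ x y * evalL L₃ r s + evalL L₁ x y * evalL L₂ r s * evalL L₃ x y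
  + evalL L₁ r s * evalL L₂ x y * evalL L₃ x y
derivative-lin3 (lin u₁ v₁) (lin u₂ v₂) (lin u₃ v₃) x y r s = identity u₁ v₁ u₂ v₂ u₃ v₃ x y r s
  where
  identity : ∀ u₁ v₁ u₂ v₂ u₃ v₃ x y r s →
    let L₁ = λ x y → u₁ * x + v₁ * y
        L₂ = λ x y → u₂ * x + v₂ * y
        L₃ = λ x y → u₃ * x + v₃ * y
    in u₁ * u₂ * u₃ * (+ 3 * (x * x * r))
       + (u₁ * u₂ * v₃ + u₁ * v₂ * u₃ + v₁ * u₂ * u₃) * (x * x * s + + 2 * (x * r * y))
       + (u₁ * v₂ * v₃ + v₁ * u₂ * v₃ + v₁ * v₂ * u₃) * (r * y * y + + 2 * (x * y * s))
       + v₁ * v₂ * v₃ * (+ 3 * (y * y * s))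
         ≡ L₁ x y * L₂ x y * L₃ r s + L₁ x y * L₂ r s * L₃ x y + L₁ r s * L₂ x y * L₃ x y
  identity = solve-∀

lin3-∘F : ∀ L₁ L₂ L₃ g → lin3 L₁ L₂ L₃ ∘F g ≋F lin3 (L₁ ∘L g) (L₂ ∘L g) (L₃ ∘L g)
lin3-∘F L₁ L₂ L₃ (mat p q r s) = form≋
  (≋-reflexive (evalF-lin3 L₁ L₂ L₃ p q))
  (≋-reflexive (derivative-lin3 L₁ L₂ L₃ p q r s))
  (≋-reflexive (trans (derivative-lin3 L₁ L₂ L₃ r s p q)
                      (+-reverse (m₁ * m₂ * ℓ₃) (m₁ * ℓ₂ * m₃) (ℓ₁ * m₂ * m₃))))
  (≋-reflexive (evalF-lin3 L₁ L₂ L₃ r s))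
  where
  ℓ₁ ℓ₂ ℓ₃ m₁ m₂ m₃ : ℤ
  ℓ₁ = evalL L₁ p q
  ℓ₂ = evalL L₂ p q
  ℓ₃ = evalL L₃ p q
  m₁ = evalL L₁ r s
  m₂ = evalL L₂ r s
  m₃ = evalL L₃ r s
  +-reverse : ∀ x y z → x + y + z ≡ z + y + x
  +-reverse = solve-∀

∘F-lin3 : ∀ {F} L₁ L₂ L₃ g → F ≋F lin3 L₁ L₂ L₃ → F ∘F g ≋F lin3 (L₁ ∘L g) (L₂ ∘L g) (L₃ ∘L g)
∘F-lin3 L₁ L₂ L₃ g F≋ = ≋F-trans (∘F-cong g F≋) (lin3-∘F L₁ L₂ L₃ g)

-- Maximality excludes F ≡ 0 (mod 3)

infixr 7 _·F_
_·F_ : ℤ → Form → Form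
n ·F F = form (n * a F) (n * b F) (n * c F) (n * d F)

-- 1 ↦ 1, α ↦ mα, β ↦ mβ, a ring embedding R_{mF} → R_F.
scaling : ℤ → Mat
scaling m 0F = vec (+ 1) (+ 0) (+ 0)
scaling m 1F = vec (+ 0) m (+ 0)
scaling m 2F = vec (+ 0) (+ 0) m

-- Copies of vec, sum3, tableF, mulT and applyM over the solver's expressions. Evaluating them gives
-- back the originals definitionally, so the ring axioms of R_F and the multiplicativity of the
-- embedding below are polynomial identities which the solver checks.
private
  module Symbolic {n : ℕ} where
    E : Set
    E = Expr ℤ n

    vecE : E → E → E → Fin 3 → E
    vecE x y z 0F = x
    vecE x y z 1F = y
    vecE x y z 2F = z

    sum3E : (Fin 3 → E) → E
    sum3E f = f 0F ⊕ f 1F ⊕ f 2F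

    tableE : E → E → E → E → Fin 3 → Fin 3 → Fin 3 → E
    tableE a b c d 0F 0F = vecE (Κ (+ 1)) (Κ (+ 0)) (Κ (+ 0))
    tableE a b c d 0F 1F = vecE (Κ (+ 0)) (Κ (+ 1)) (Κ (+ 0))
    tableE a b c d 0F 2F = vecE (Κ (+ 0)) (Κ (+ 0)) (Κ (+ 1))
    tableE a b c d 1F 0F = vecE (Κ (+ 0)) (Κ (+ 1)) (Κ (+ 0))
    tableE a b c d 2F 0F = vecE (Κ (+ 0)) (Κ (+ 0)) (Κ (+ 1))
    tableE a b c d 1F 1F = vecE (⊝ (a ⊗ c)) (⊝ b) a
    tableE a b c d 1F 2F = vecE (⊝ (a ⊗ d)) (Κ (+ 0)) (Κ (+ 0))
    tableE a b c d 2F 1F = vecE (⊝ (a ⊗ d)) (Κ (+ 0)) (Κ (+ 0))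
    tableE a b c d 2F 2F = vecE (⊝ (b ⊗ d)) (⊝ d) c

    mulE : (Fin 3 → Fin 3 → Fin 3 → E) → (Fin 3 → E) → (Fin 3 → E) → Fin 3 → E
    mulE t x y k = sum3E (λ i → sum3E (λ j → x i ⊗ y j ⊗ t i j k))

    applyE : (Fin 3 → Fin 3 → E) → (Fin 3 → E) → Fin 3 → E
    applyE M x k = sum3E (λ i → x i ⊗ M i k)

    scalingE : E → Fin 3 → Fin 3 → E
    scalingE m 0F = vecE (Κ (+ 1)) (Κ (+ 0)) (Κ (+ 0))
    scalingE m 1F = vecE (Κ (+ 0)) m (Κ (+ 0))
    scalingE m 2F = vecE (Κ (+ 0)) (Κ (+ 0)) m

    commutativity : Fin 3 → N-ary 10 E (E × E)
    commutativity k a b c d x₀ x₁ x₂ y₀ y₁ y₂ =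
      let t = tableE a b c d; x = vecE x₀ x₁ x₂; y = vecE y₀ y₁ y₂ in mulE t x y k ⊜ mulE t y x k

    associativity : Fin 3 → N-ary 13 E (E × E)
    associativity k a b c d x₀ x₁ x₂ y₀ y₁ y₂ z₀ z₁ z₂ =
      let t = tableE a b c d; x = vecE x₀ x₁ x₂; y = vecE y₀ y₁ y₂; z = vecE z₀ z₁ z₂ in
      mulE t (mulE t x y) z k ⊜ mulE t x (mulE t y z) k

    left-unit : Fin 3 → N-ary 7 E (E × E)
    left-unit k a b c d x₀ x₁ x₂ =
      mulE (tableE a b c d) (vecE (Κ (+ 1)) (Κ (+ 0)) (Κ (+ 0))) (vecE x₀ x₁ x₂) k ⊜ vecE x₀ x₁ x₂ k

    scaling-apply : Fin 3 → N-ary 4 E (E × E)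
    scaling-apply k m x₀ x₁ x₂ = applyE (scalingE m) (vecE x₀ x₁ x₂) k ⊜ vecE x₀ (m ⊗ x₁) (m ⊗ x₂) k

    scaling-hom : Fin 3 → N-ary 11 E (E × E)
    scaling-hom k m a b c d x₀ x₁ x₂ y₀ y₁ y₂ =
      let φ = scalingE m; x = vecE x₀ x₁ x₂; y = vecE y₀ y₁ y₂ in
      applyE φ (mulE (tableE (m ⊗ a) (m ⊗ b) (m ⊗ c) (m ⊗ d)) x y) k
        ⊜ mulE (tableE a b c d) (applyE φ x) (applyE φ y) k

  R-comm : ∀ k a b c d x₀ x₁ x₂ y₀ y₁ y₂ →
    let t = tableF (form a b c d); x = vec x₀ x₁ x₂; y = vec y₀ y₁ y₂ in mulT t x y k ≡ mulT t y x k
  R-comm 0F = solveExpr 10 (Symbolic.commutativity 0F) refl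
  R-comm 1F = solveExpr 10 (Symbolic.commutativity 1F) refl
  R-comm 2F = solveExpr 10 (Symbolic.commutativity 2F) refl

  R-assoc : ∀ k a b c d x₀ x₁ x₂ y₀ y₁ y₂ z₀ z₁ z₂ →
    let t = tableF (form a b c d); x = vec x₀ x₁ x₂; y = vec y₀ y₁ y₂; z = vec z₀ z₁ z₂ in
    mulT t (mulT t x y) z k ≡ mulT t x (mulT t y z) k
  R-assoc 0F = solveExpr 13 (Symbolic.associativity 0F) refl
  R-assoc 1F = solveExpr 13 (Symbolic.associativity 1F) refl
  R-assoc 2F = solveExpr 13 (Symbolic.associativity 2F) refl

  R-unitˡ : ∀ k a b c d x₀ x₁ x₂ → mulT (tableF (form a b c d)) oneF (vec x₀ x₁ x₂) k ≡ vec x₀ x₁ x₂ k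
  R-unitˡ 0F = solveExpr 7 (Symbolic.left-unit 0F) refl
  R-unitˡ 1F = solveExpr 7 (Symbolic.left-unit 1F) refl
  R-unitˡ 2F = solveExpr 7 (Symbolic.left-unit 2F) refl

  scaling-apply : ∀ k m x₀ x₁ x₂ → applyM (scaling m) (vec x₀ x₁ x₂) k ≡ vec x₀ (m * x₁) (m * x₂) k
  scaling-apply 0F = solveExpr 4 (Symbolic.scaling-apply 0F) refl
  scaling-apply 1F = solveExpr 4 (Symbolic.scaling-apply 1F) refl
  scaling-apply 2F = solveExpr 4 (Symbolic.scaling-apply 2F) refl

  scaling-hom : ∀ k m a b c d x₀ x₁ x₂ y₀ y₁ y₂ →
    let φ = scaling m; x = vec x₀ x₁ x₂; y = vec y₀ y₁ y₂ in
    applyM φ (mulT (tableF (m ·F form a b c d)) x y) k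
      ≡ mulT (tableF (form a b c d)) (applyM φ x) (applyM φ y) k
  scaling-hom 0F = solveExpr 11 (Symbolic.scaling-hom 0F) refl
  scaling-hom 1F = solveExpr 11 (Symbolic.scaling-hom 1F) refl
  scaling-hom 2F = solveExpr 11 (Symbolic.scaling-hom 2F) refl

vec-η : (x : V) → vec (x 0F) (x 1F) (x 2F) ≈ x
vec-η x 0F = refl
vec-η x 1F = refl
vec-η x 2F = refl

cubicRing : Form → CubicRing
cubicRing F = record
  { table = tableF F
  ; one   = oneF
  ; comm  = λ x y k → R-comm k (a F) (b F) (c F) (d F) (x 0F) (x 1F) (x 2F) (y 0F) (y 1F) (y 2F)
  ; assoc = λ x y z k →
      R-assoc k (a F) (b F) (c F) (d F) (x 0F) (x 1F) (x 2F) (y 0F) (y 1F) (y 2F) (z 0F) (z 1F) (z 2F)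
  ; unitˡ = λ x k → trans (R-unitˡ k (a F) (b F) (c F) (d F) (x 0F) (x 1F) (x 2F)) (vec-η x k)
  }

multiple-not-maximal : ∀ n .{{_ : NonTrivial n}} F → ¬ MaximalRF (+ n ·F F)
multiple-not-maximal n F maximal = maximal (cubicRing F)
  (φ , φ-one , φ-hom , φ-injective , (vec (+ 0) (+ 1) (+ 0) , φ-not-onto) , (+ n , +n≢0 , φ-index))
  where
  instance
    _ = nonTrivial⇒nonZero n
  φ : Mat
  φ = scaling (+ n)
  φ-apply : ∀ x → applyM φ x ≈ vec (x 0F) (+ n * x 1F) (+ n * x 2F)
  φ-apply x k = scaling-apply k (+ n) (x 0F) (x 1F) (x 2F)
  φ-one : applyM φ oneF ≈ oneF
  φ-one 0F = refl
  φ-one 1F = refl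
  φ-one 2F = refl
  φ-hom : ∀ x y → applyM φ (mulT (tableF (+ n ·F F)) x y) ≈ mulT (tableF F) (applyM φ x) (applyM φ y)
  φ-hom x y k = scaling-hom k (+ n) (a F) (b F) (c F) (d F) (x 0F) (x 1F) (x 2F) (y 0F) (y 1F) (y 2F)
  φ-injective : ∀ x y → applyM φ x ≈ applyM φ y → x ≈ y
  φ-injective x y φx≈φy 0F = trans (sym (φ-apply x 0F)) (trans (φx≈φy 0F) (φ-apply y 0F))
  φ-injective x y φx≈φy 1F = *-cancelˡ-≡ (+ n) _ _ (trans (sym (φ-apply x 1F)) (trans (φx≈φy 1F) (φ-apply y 1F)))
  φ-injective x y φx≈φy 2F = *-cancelˡ-≡ (+ n) _ _ (trans (sym (φ-apply x 2F)) (trans (φx≈φy 2F) (φ-apply y 2F)))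
  φ-not-onto : ∀ x → ¬ applyM φ x ≈ vec (+ 0) (+ 1) (+ 0)
  φ-not-onto x φx≈α = <-irrefl refl (subst (1 <_) n≡1 (nonTrivial⇒n>1 n))
    where
    n∣1 : + n Signed.∣ + 1
    n∣1 = Signed.divides (x 1F) (trans (sym (φx≈α 1F)) (trans (φ-apply x 1F) (*-comm (+ n) (x 1F))))
    n≡1 : n ≡ 1
    n≡1 = ℕ.∣1⇒≡1 (Signed.∣⇒∣ᵤ n∣1)
  +n≢0 : + n ≢ + 0
  +n≢0 = ≢-nonZero⁻¹ n ∘ +-injective
  φ-index : ∀ y → Σ V λ x → applyM φ x ≈ scaleV (+ n) y
  φ-index y = preimage , λ k → trans (φ-apply preimage k) (scaled k)
    where
    preimage : V
    preimage = vec (+ n * y 0F) (y 1F) (y 2F)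
    scaled : vec (preimage 0F) (+ n * preimage 1F) (+ n * preimage 2F) ≈ scaleV (+ n) y
    scaled 0F = refl
    scaled 1F = refl
    scaled 2F = refl

≋0⇒3∣ : x ≋ + 0 → Σ ℤ λ q → x ≡ + 3 * q
≋0⇒3∣ {x} (mod3 (Signed.divides q x-0≡q*3)) =
  q , sym (trans (*-comm (+ 3) q) (trans (sym x-0≡q*3) (solve (x ∷ []))))

maximal⇒≉0 : ∀ F → MaximalRF F → ¬ F ≋F form (+ 0) (+ 0) (+ 0) (+ 0)
maximal⇒≉0 (form a b c d) maximal (form≋ a≋0 b≋0 c≋0 d≋0)
  with ≋0⇒3∣ a≋0 | ≋0⇒3∣ b≋0 | ≋0⇒3∣ c≋0 | ≋0⇒3∣ d≋0
... | qa , refl | qb , refl | qc , refl | qd , refl = multiple-not-maximal 3 (form qa qb qc qd) maximal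

coefficients-≋y³ : ∀ {F} L → UnitMultipleOfY L → F ≋F lin3 L L L →
  (a F ≡₃ + 0) × (b F ≡₃ + 0) × (c F ≡₃ + 0) × ¬ (d F ≡₃ + 0)
coefficients-≋y³ {F} (lin z w) (z≋0 , w≉0) F≋L³ =
  ≋⇒≡₃ a≋ , ≋⇒≡₃ b≋ , ≋⇒≡₃ c≋ , ≉0⇒≢₃0 (x≉0∧y≉0⇒xy≉0 (x≉0∧y≉0⇒xy≉0 w≉0 w≉0) w≉0) d≋
  where
  L≋wy : lin z w ≋L lin (+ 0) w
  L≋wy = lin≋ z≋0 ≋-refl
  F≋w³y³ : F ≋F form (+ 0) (+ 0) (+ 0) (w * w * w)
  F≋w³y³ = begin
    F                                               ≈⟨ F≋L³ ⟩
    lin3 (lin z w) (lin z w) (lin z w)              ≈⟨ lin3-cong L≋wy L≋wy L≋wy ⟩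
    lin3 (lin (+ 0) w) (lin (+ 0) w) (lin (+ 0) w)  ≈⟨ form≋ ≋-refl (≋-reflexive b≡0) (≋-reflexive c≡0) ≋-refl ⟩
    form (+ 0) (+ 0) (+ 0) (w * w * w)              ∎
    where
    open ≋F-Reasoning
    b≡0 : + 0 * + 0 * w + + 0 * w * + 0 + w * + 0 * + 0 ≡ + 0
    b≡0 = solve (w ∷ [])
    c≡0 : + 0 * w * w + w * + 0 * w + w * w * + 0 ≡ + 0
    c≡0 = solve (w ∷ [])
  open _≋F_ F≋w³y³

coefficients-≋xy² : ∀ {F} L M → UnitMultipleOfX L → UnitMultipleOfY M → F ≋F lin3 L M M →
  (a F ≡₃ + 0) × (b F ≡₃ + 0) × (d F ≡₃ + 0) × ¬ (c F ≡₃ + 0)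
coefficients-≋xy² {F} (lin w₁ z₁) (lin z₂ w₂) (w₁≉0 , z₁≋0) (z₂≋0 , w₂≉0) F≋LM² =
  ≋⇒≡₃ a≋ , ≋⇒≡₃ b≋ , ≋⇒≡₃ d≋ , ≉0⇒≢₃0 (x≉0∧y≉0⇒xy≉0 (x≉0∧y≉0⇒xy≉0 w₁≉0 w₂≉0) w₂≉0) c≋
  where
  L≋w₁x : lin w₁ z₁ ≋L lin w₁ (+ 0)
  L≋w₁x = lin≋ ≋-refl z₁≋0
  M≋w₂y : lin z₂ w₂ ≋L lin (+ 0) w₂
  M≋w₂y = lin≋ z₂≋0 ≋-refl
  F≋w₁w₂²xy² : F ≋F form (+ 0) (+ 0) (w₁ * w₂ * w₂) (+ 0)
  F≋w₁w₂²xy² = begin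
    F                                                  ≈⟨ F≋LM² ⟩
    lin3 (lin w₁ z₁) (lin z₂ w₂) (lin z₂ w₂)           ≈⟨ lin3-cong L≋w₁x M≋w₂y M≋w₂y ⟩
    lin3 (lin w₁ (+ 0)) (lin (+ 0) w₂) (lin (+ 0) w₂)
      ≈⟨ form≋ (≋-reflexive a≡0) (≋-reflexive b≡0) (≋-reflexive c≡) (≋-reflexive d≡0) ⟩
    form (+ 0) (+ 0) (w₁ * w₂ * w₂) (+ 0)              ∎
    where
    open ≋F-Reasoning
    a≡0 : w₁ * + 0 * + 0 ≡ + 0
    a≡0 = solve (w₁ ∷ [])
    b≡0 : w₁ * + 0 * w₂ + w₁ * w₂ * + 0 + + 0 * + 0 * + 0 ≡ + 0
    b≡0 = solve (w₁ ∷ w₂ ∷ [])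
    c≡ : w₁ * w₂ * w₂ + + 0 * + 0 * w₂ + + 0 * w₂ * + 0 ≡ w₁ * w₂ * w₂
    c≡ = solve (w₁ ∷ w₂ ∷ [])
    d≡0 : + 0 * w₂ * w₂ ≡ + 0
    d≡0 = solve (w₂ ∷ [])
  open _≋F_ F≋w₁w₂²xy²

lemma4p2 : (F : Form) → MaximalRF F →
    ((Σ Lin λ L → F ≡F₃ lin3 L L L) →
      Σ Form λ G → GL₂Equiv F G × (a G ≡₃ + 0) × (b G ≡₃ + 0) × (c G ≡₃ + 0) × ¬ (d G ≡₃ + 0))
    × ((Σ Lin λ G₁ → Σ Lin λ G₂ → ¬ ConstMult₃ G₁ G₂ × (F ≡F₃ lin3 G₁ G₂ G₂)) →
      Σ Form λ G → GL₂Equiv F G × (a G ≡₃ + 0) × (b G ≡₃ + 0) × (d G ≡₃ + 0) × ¬ (c G ≡₃ + 0))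
lemma4p2 F maximal = cube-case , square-case
  where
  cube-case : (Σ Lin λ L → F ≡F₃ lin3 L L L) →
    Σ Form λ G → GL₂Equiv F G × (a G ≡₃ + 0) × (b G ≡₃ + 0) × (c G ≡₃ + 0) × ¬ (d G ≡₃ + 0)
  cube-case (L , F≡L³) =
    let F≋L³ : F ≋F lin3 L L L
        F≋L³ = ≡F₃⇒≋F F≡L³
        L≉0 = λ L≋0 → maximal⇒≉0 F maximal (≋F-trans F≋L³ (lin3-cong L≋0 L≋0 L≋0))
        g , det-g≡1 , L∘g-y = align-y L L≉0
    in F ∘F g , GL₂Equiv-∘F F g det-g≡1 , coefficients-≋y³ (L ∘L g) L∘g-y (∘F-lin3 L L L g F≋L³)
  square-case : (Σ Lin λ G₁ → Σ Lin λ G₂ → ¬ ConstMult₃ G₁ G₂ × (F ≡F₃ lin3 G₁ G₂ G₂)) →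
    Σ Form λ G → GL₂Equiv F G × (a G ≡₃ + 0) × (b G ≡₃ + 0) × (d G ≡₃ + 0) × ¬ (c G ≡₃ + 0)
  square-case (G₁ , G₂ , independent , F≡G₁G₂²) =
    let F≋G₁G₂² : F ≋F lin3 G₁ G₂ G₂
        F≋G₁G₂² = ≡F₃⇒≋F F≡G₁G₂²
        g , det-g≡1 , G₁∘g-x , G₂∘g-y = align-xy G₁ G₂ (independent ∘ cross≋0⇒ConstMult₃ G₁ G₂)
    in F ∘F g , GL₂Equiv-∘F F g det-g≡1 ,
       coefficients-≋xy² (G₁ ∘L g) (G₂ ∘L g) G₁∘g-x G₂∘g-y (∘F-lin3 G₁ G₂ G₂ g F≋G₁G₂²)
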